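{- Let $(G,\sigma)$ be a signed graph and let $(H,\pi)$ be an elementary homomorphic image of $(G,\sigma)$. Then $$\chi(G,\sigma)\le\chi(H,\pi)\le\chi(G,\sigma)+1.$$
   Context: A signed graph $(G,\sigma)$ is a finite simple graph $G$ with a signature $\sigma:E(G)\to\{ -,+\}$. Switching a set $S\subseteq V(G)$ changes the sign of every edge with exactly one end in $S$. For $k\ge1$ let $M_k=\{ -n,\dots,-1,+1,\dots,+n\}$ if $k=2n$, and $M_k=\{ -n,\dots,-1,\pm0,+1,\dots,+n\}$ if $k=2n+1$, where $\pm0$ is a single colour with $-(\pm0)=\pm0$. A $k$-colouring $\phi:V(G)\to M_k$ is proper if $\phi(u)\ne\sigma(uv)\phi(v)$ for every edge $uv$ (where $\sigma(uv)\phi(v)=\phi(v)$ if $\sigma(uv)=+$ and $-\phi(v)$ otherwise). The chromatic number $\chi(G,\sigma)$ is the smallest $k\ge1$ such that $(G,\sigma)$ admits a proper $k$-colouring. Two vertices $u,v$ of $(G,\sigma)$ are identifiable if they are non-adjacent and, after possibly switching $u$ or $v$, $\sigma(uw)=\sigma(vw)$ for every common neighbour $w$ of $u$ and $v$. An elementary homomorphic image of $(G,\sigma)$ is the signed graph obtained from $(G,\sigma)$ (after this possible switching) by identifying two identifiable vertices $u,v$ into a single vertex adjacent to all neighbours of $u$ and of $v$, each such edge keeping its sign (the result being simple). -}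

module Defs where

open import Data.Nat using (ℕ; suc; _+_; _*_; _≤_; _<_)
open import Data.Integer using (ℤ; ∣_∣; -_)
open import Data.Fin using (Fin)
open import Data.Bool using (Bool; true; false; _xor_)
open import Data.Maybe using (Maybe; just; nothing)
open import Data.Product using (Σ; ∃; _×_; _,_)
open import Data.Sum using (_⊎_)
open import Relation.Nullary using (¬_)
open import Relation.Binary.PropositionalEquality using (_≡_; _≢_)
open import Relation.Nullary.Decidable using (⌊_⌋)
open import Data.Fin using (_≟_)

data Sign : Set where
  plus minus : Sign

-- σ(e)·c for a colour c ∈ ℤ  (−(±0) = ±0 automatically, since ±0 is 0)
act : Sign → ℤ → ℤ
act plus  c = c
act minus c = - c

flip : Sign → Sign
flip plus  = minus
flip minus = plus

record SignedGraph : Set where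
  field
    n       : ℕ
    adj     : Fin n → Fin n → Maybe Sign
    sym     : ∀ u v → adj u v ≡ adj v u
    loopless : ∀ u → adj u u ≡ nothing
open SignedGraph public

-- Colour set M_k, with colours represented as integers (±0 is 0):
-- k = 2m   : {-m,…,-1,+1,…,+m}
-- k = 2m+1 : {-m,…,-1,0,+1,…,+m}
M : ℕ → ℤ → Set
M k c = (∃ λ m → k ≡ 2 * m × 1 ≤ ∣ c ∣ × ∣ c ∣ ≤ m)
      ⊎ (∃ λ m → k ≡ 2 * m + 1 × ∣ c ∣ ≤ m)

ProperColouring : (G : SignedGraph) → ℕ → (Fin (n G) → ℤ) → Set
ProperColouring G k φ =
  (∀ u → M k (φ u)) ×
  (∀ u v s → adj G u v ≡ just s → φ u ≢ act s (φ v))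

Colourable : SignedGraph → ℕ → Set
Colourable G k = Σ (Fin (n G) → ℤ) (ProperColouring G k)

IsChromaticNumber : SignedGraph → ℕ → Set
IsChromaticNumber G k =
  1 ≤ k × Colourable G k × (∀ j → 1 ≤ j → j < k → ¬ Colourable G j)

switchAdj : (G : SignedGraph) → (Fin (n G) → Bool) →
            Fin (n G) → Fin (n G) → Maybe Sign
switchAdj G S u v with adj G u v | S u xor S v
... | nothing | _     = nothing
... | just s  | false = just s
... | just s  | true  = just (flip s)

single : ∀ {m} → Fin m → Fin m → Bool
single x y = ⌊ x ≟ y ⌋

noSwitch : ∀ {m} → Fin m → Bool
noSwitch _ = false

Identifiable : ∀ {m} → (Fin m → Fin m → Maybe Sign) → Fin m → Fin m → Set
Identifiable a u v =
  u ≢ v × a u v ≡ nothing ×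
  (∀ w s t → a u w ≡ just s → a v w ≡ just t → s ≡ t)

-- H is (isomorphic to) the signed graph obtained from a' by identifying
-- u and v: f : V(G) → V(H) is surjective, identifies exactly u and v,
-- and the edges of H are exactly the images of the edges of a', with signs.
IdentifiedBy : (G H : SignedGraph) → (Fin (n G) → Fin (n G) → Maybe Sign) →
               Fin (n G) → Fin (n G) → (Fin (n G) → Fin (n H)) → Set
IdentifiedBy G H a u v f =
  f u ≡ f v ×
  (∀ x y → f x ≡ f y → x ≡ y ⊎ (x ≡ u × y ≡ v) ⊎ (x ≡ v × y ≡ u)) ×
  (∀ b → ∃ λ x → f x ≡ b) ×
  (∀ x y s → a x y ≡ just s → adj H (f x) (f y) ≡ just s) ×
  (∀ b c s → adj H b c ≡ just s →
     ∃ λ x → ∃ λ y → f x ≡ b × f y ≡ c × a x y ≡ just s)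

ElementaryImage : SignedGraph → SignedGraph → Set
ElementaryImage G H =
  ∃ λ (u : Fin (n G)) → ∃ λ (v : Fin (n G)) →
  ∃ λ (S : Fin (n G) → Bool) →
    (S ≡ noSwitch ⊎ S ≡ single u ⊎ S ≡ single v) ×
    Identifiable (switchAdj G S) u v ×
    ∃ λ (f : Fin (n G) → Fin (n H)) → IdentifiedBy G H (switchAdj G S) u v f

-- Switching a colouring vertex by vertex (negating the colours of the switched vertices) turns
-- proper colourings of a signed graph into proper colourings of its switching, so a k-colouring
-- of H pulls back along the identification to one of G. Conversely a k-colouring of G descends
-- to every vertex of H except the merged one, which receives one new colour: ±0 when k is even;
-- when k = 2m+1, the colour +(m+1), after the vertices coloured ±0 (an independent set) are
-- moved to ±(m+1) with the sign chosen against their edge to the merged vertex.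
module Submission where

open import Defs hiding (sym)
open import Data.Nat using (ℕ; suc; _+_; _*_; _≤_; s≤s; z≤n)
open import Data.Nat.Properties
  using (*-cancelˡ-≡; +-cancelʳ-≡; even≢odd; *-suc; +-comm; +-assoc; ≮⇒≥; m≤m+n; n≤1+n; <⇒≢;
         ≤-refl; ≤-trans)
open import Data.Integer using (ℤ; ∣_∣; -_; +_; -[1+_])
open import Data.Integer.Properties using (neg-involutive; ∣-i∣≡∣i∣) renaming (_≟_ to _≟ℤ_)
open import Data.Fin using (Fin; _≟_)
open import Data.Bool using (Bool; true; false; _xor_)
open import Data.Maybe using (Maybe; just; nothing)
open import Data.Product using (∃; _×_; _,_; proj₁; proj₂)
open import Data.Sum using (inj₁; inj₂)
open import Data.Empty using (⊥-elim)
open import Function using (_∘_)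
open import Relation.Nullary using (yes; no)
open import Relation.Binary.PropositionalEquality
  using (_≡_; _≢_; refl; sym; trans; cong; subst; module ≡-Reasoning)

data EvenOrOdd : ℕ → Set where
  even : ∀ m → EvenOrOdd (2 * m)
  odd  : ∀ m → EvenOrOdd (2 * m + 1)

2m+1+1≡2[1+m] : ∀ m → 2 * m + 1 + 1 ≡ 2 * suc m
2m+1+1≡2[1+m] m = trans (+-assoc (2 * m) 1 1) (trans (+-comm (2 * m) 2) (sym (*-suc 2 m)))

evenOrOdd : ∀ k → EvenOrOdd k
evenOrOdd 0       = even 0
evenOrOdd (suc k) = subst EvenOrOdd (+-comm k 1) (step (evenOrOdd k))
  where
  step : ∀ {j} → EvenOrOdd j → EvenOrOdd (j + 1)
  step (even m) = odd m
  step (odd m)  = subst EvenOrOdd (sym (2m+1+1≡2[1+m] m)) (even (suc m))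

M-even⁻ : ∀ m c → M (2 * m) c → 1 ≤ ∣ c ∣ × ∣ c ∣ ≤ m
M-even⁻ m c (inj₁ (m′ , e , bounds)) with *-cancelˡ-≡ m m′ 2 e
... | refl = bounds
M-even⁻ m c (inj₂ (m′ , e , _)) = ⊥-elim (even≢odd m m′ (trans e (+-comm (2 * m′) 1)))

M-odd⁻ : ∀ m c → M (2 * m + 1) c → ∣ c ∣ ≤ m
M-odd⁻ m c (inj₁ (m′ , e , _)) = ⊥-elim (even≢odd m′ m (trans (sym e) (+-comm (2 * m) 1)))
M-odd⁻ m c (inj₂ (m′ , e , bound)) with *-cancelˡ-≡ m m′ 2 (+-cancelʳ-≡ 1 (2 * m) (2 * m′) e)
... | refl = bound

∣act∣ : ∀ s c → ∣ act s c ∣ ≡ ∣ c ∣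
∣act∣ plus  c = refl
∣act∣ minus c = ∣-i∣≡∣i∣ c

M-act : ∀ {k} s c → M k c → M k (act s c)
M-act s c colour rewrite ∣act∣ s c = colour

act-involutive : ∀ s c → act s (act s c) ≡ c
act-involutive plus  c = refl
act-involutive minus c = neg-involutive c

act-injective : ∀ s {a b} → act s a ≡ act s b → a ≡ b
act-injective s {a} {b} e =
  trans (sym (act-involutive s a)) (trans (cong (act s) e) (act-involutive s b))

act-zero : ∀ s → act s (+ 0) ≡ + 0
act-zero plus  = refl
act-zero minus = refl

≢act-sym : ∀ {a b} s → a ≢ act s b → b ≢ act s a
≢act-sym {a} {b} s a≢ b≡ = a≢ (trans (sym (act-involutive s a)) (cong (act s) (sym b≡)))

∣∣≢⇒≢act : ∀ {a b} s → ∣ a ∣ ≢ ∣ b ∣ → a ≢ act s b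
∣∣≢⇒≢act {b = b} s ne a≡ = ne (trans (cong ∣_∣ a≡) (∣act∣ s b))

sign : Bool → Sign
sign false = plus
sign true  = minus

flipIf : Bool → Sign → Sign
flipIf false s = s
flipIf true  s = flip s

switchAdj-just : ∀ G S {x y s} → adj G x y ≡ just s →
                 switchAdj G S x y ≡ just (flipIf (S x xor S y) s)
switchAdj-just G S {x} {y} e with adj G x y | S x xor S y
switchAdj-just G S refl | just _ | false = refl
switchAdj-just G S refl | just _ | true  = refl

switchAdj-just⁻ : ∀ G S {x y s} → switchAdj G S x y ≡ just s →
                  ∃ λ s₀ → adj G x y ≡ just s₀ × s ≡ flipIf (S x xor S y) s₀
switchAdj-just⁻ G S {x} {y} e with adj G x y | S x xor S y
switchAdj-just⁻ G S ()   | nothing | _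
switchAdj-just⁻ G S refl | just s₀ | false = s₀ , refl , refl
switchAdj-just⁻ G S refl | just s₀ | true  = s₀ , refl , refl

act-flipIf-xor : ∀ p q s c → act (sign p) (act (flipIf (p xor q) s) c) ≡ act s (act (sign q) c)
act-flipIf-xor false false s     c = refl
act-flipIf-xor false true  plus  c = refl
act-flipIf-xor false true  minus c = sym (neg-involutive c)
act-flipIf-xor true  false plus  c = neg-involutive c
act-flipIf-xor true  false minus c = refl
act-flipIf-xor true  true  plus  c = refl
act-flipIf-xor true  true  minus c = refl

Adjacency : ℕ → Set
Adjacency m = Fin m → Fin m → Maybe Sign

Proper : ∀ {m} → Adjacency m → (Fin m → ℤ) → Set
Proper a φ = ∀ x y s → a x y ≡ just s → φ x ≢ act s (φ y)

switchColouring : ∀ {m} → (Fin m → Bool) → (Fin m → ℤ) → Fin m → ℤ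
switchColouring S φ x = act (sign (S x)) (φ x)

proper-switch : ∀ G S {φ} → Proper (adj G) φ → Proper (switchAdj G S) (switchColouring S φ)
proper-switch G S {φ} proper x y s e conflict with switchAdj-just⁻ G S e
... | s₀ , e₀ , refl = proper x y s₀ e₀ (begin
  φ x                                                 ≡⟨ sym (act-involutive p (φ x)) ⟩
  act p (act p (φ x))                                 ≡⟨ cong (act p) conflict ⟩
  act p (act (flipIf (S x xor S y) s₀) (act q (φ y))) ≡⟨ act-flipIf-xor (S x) (S y) s₀ _ ⟩
  act s₀ (act q (act q (φ y)))                        ≡⟨ cong (act s₀) (act-involutive q (φ y)) ⟩
  act s₀ (φ y)                                        ∎)
  where
  open ≡-Reasoning
  p = sign (S x)
  q = sign (S y)

proper-unswitch : ∀ G S {φ} → Proper (switchAdj G S) φ → Proper (adj G) (switchColouring S φ)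
proper-unswitch G S {φ} proper x y s e conflict =
  proper x y _ (switchAdj-just G S e)
    (act-injective (sign (S x)) (trans conflict (sym (act-flipIf-xor (S x) (S y) s (φ y)))))

EdgePreserving : ∀ {m m′} → Adjacency m → Adjacency m′ → (Fin m → Fin m′) → Set
EdgePreserving a b f = ∀ x y s → a x y ≡ just s → b (f x) (f y) ≡ just s

proper-pullback : ∀ {m m′} {a : Adjacency m} {b : Adjacency m′} {f ψ} →
                  EdgePreserving a b f → Proper b ψ → Proper a (ψ ∘ f)
proper-pullback preserves proper x y s e = proper _ _ s (preserves x y s e)

colourable-pullback : ∀ G H S {f k} → EdgePreserving (switchAdj G S) (adj H) f →
                      Colourable H k → Colourable G k
colourable-pullback G H S preserves (ψ , colours , proper) =
  switchColouring S (ψ ∘ _) ,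
  (λ x → M-act (sign (S x)) _ (colours _)) ,
  proper-unswitch G S (proper-pullback preserves proper)

ProperAway : (G : SignedGraph) → Fin (n G) → (Fin (n G) → ℤ) → Set
ProperAway G w φ = ∀ x y s → x ≢ w → y ≢ w → adj G x y ≡ just s → φ x ≢ act s (φ y)

assign : ∀ {m} → Fin m → ℤ → (Fin m → ℤ) → Fin m → ℤ
assign w c φ x with x ≟ w
... | yes _ = c
... | no  _ = φ x

assign-colours : ∀ {m k} w {c} {φ : Fin m → ℤ} → M k c → (∀ x → x ≢ w → M k (φ x)) →
                 ∀ x → M k (assign w c φ x)
assign-colours w colour colours x with x ≟ w
... | yes _  = colour
... | no x≢w = colours x x≢w

no-loop : ∀ G {w s} → adj G w w ≢ just s
no-loop G {w} e with trans (sym e) (loopless G w)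
... | ()

proper-assign : ∀ G w {c φ} → ProperAway G w φ →
                (∀ x s → x ≢ w → adj G x w ≡ just s → φ x ≢ act s c) →
                Proper (adj G) (assign w c φ)
proper-assign G w {c} {φ} away toward x y s e with x ≟ w | y ≟ w
... | yes refl | yes refl = ⊥-elim (no-loop G e)
... | yes refl | no y≢w   = ≢act-sym s (toward y s y≢w (trans (SignedGraph.sym G y w) e))
... | no x≢w   | yes refl = toward x s x≢w e
... | no x≢w   | no y≢w   = away x y s x≢w y≢w e

module EvenExtension (G : SignedGraph) (w : Fin (n G)) (m : ℕ) (φ : Fin (n G) → ℤ)
                     (colours : ∀ x → M (2 * m) (φ x)) (away : ProperAway G w φ) where

  toward : ∀ x s → x ≢ w → adj G x w ≡ just s → φ x ≢ act s (+ 0)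
  toward x s _ _ = ∣∣≢⇒≢act s (λ eq → <⇒≢ (proj₁ (M-even⁻ m (φ x) (colours x))) (sym eq))

  colourable : Colourable G (2 * m + 1)
  colourable =
    assign w (+ 0) φ ,
    assign-colours w (inj₂ (m , refl , z≤n))
      (λ x _ → inj₂ (m , refl , proj₂ (M-even⁻ m (φ x) (colours x)))) ,
    proper-assign G w away toward

module OddExtension (G : SignedGraph) (w : Fin (n G)) (m : ℕ) (φ : Fin (n G) → ℤ)
                    (colours : ∀ x → M (2 * m + 1) (φ x)) (away : ProperAway G w φ) where

  bounded : ∀ x → ∣ φ x ∣ ≢ suc m
  bounded x = <⇒≢ (s≤s (M-odd⁻ m (φ x) (colours x)))

  -- A colour of absolute value m+1 that does not conflict with +(m+1) across the given edge.
  sideColour : Maybe Sign → ℤ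
  sideColour (just plus) = -[1+ m ]
  sideColour _           = + suc m

  ∣sideColour∣ : ∀ e → ∣ sideColour e ∣ ≡ suc m
  ∣sideColour∣ (just plus)  = refl
  ∣sideColour∣ (just minus) = refl
  ∣sideColour∣ nothing      = refl

  recolour : Fin (n G) → ℤ
  recolour x with φ x ≟ℤ + 0
  ... | yes _ = sideColour (adj G x w)
  ... | no  _ = φ x

  M-top : ∀ c → 1 ≤ ∣ c ∣ → ∣ c ∣ ≤ suc m → M (2 * m + 1 + 1) c
  M-top c lower upper = inj₁ (suc m , 2m+1+1≡2[1+m] m , lower , upper)

  M-top-exact : ∀ c → ∣ c ∣ ≡ suc m → M (2 * m + 1 + 1) c
  M-top-exact c ∣c∣≡ =
    M-top c (subst (1 ≤_) (sym ∣c∣≡) (s≤s z≤n)) (subst (_≤ suc m) (sym ∣c∣≡) ≤-refl)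

  recolour-colours : ∀ x → M (2 * m + 1 + 1) (recolour x)
  recolour-colours x with φ x ≟ℤ + 0
  ... | yes _ = M-top-exact (sideColour (adj G x w)) (∣sideColour∣ (adj G x w))
  ... | no φx≢0 =
    M-top (φ x) (nonzero (φ x) φx≢0) (≤-trans (M-odd⁻ m (φ x) (colours x)) (n≤1+n m))
    where
    nonzero : ∀ c → c ≢ + 0 → 1 ≤ ∣ c ∣
    nonzero (+ 0)     c≢0 = ⊥-elim (c≢0 refl)
    nonzero (+ suc _) _   = s≤s z≤n
    nonzero -[1+ _ ]  _   = s≤s z≤n

  -- Two vertices coloured ±0 are never adjacent, since ±0 conflicts with itself across any edge.
  recolour-away : ProperAway G w recolour
  recolour-away x y s x≢w y≢w e with φ x ≟ℤ + 0 | φ y ≟ℤ + 0 | away x y s x≢w y≢w e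
  ... | yes φx≡0 | yes φy≡0 | proper =
    λ _ → proper (trans φx≡0 (sym (trans (cong (act s) φy≡0) (act-zero s))))
  ... | yes _ | no _ | _ =
    ∣∣≢⇒≢act s (λ eq → bounded y (trans (sym eq) (∣sideColour∣ (adj G x w))))
  ... | no _ | yes _ | _ =
    ∣∣≢⇒≢act s (λ eq → bounded x (trans eq (∣sideColour∣ (adj G y w))))
  ... | no _ | no _ | proper = proper

  toward : ∀ x s → x ≢ w → adj G x w ≡ just s → recolour x ≢ act s (+ suc m)
  toward x s _ e with φ x ≟ℤ + 0
  toward x plus  _ e | yes _ rewrite e = λ ()
  toward x minus _ e | yes _ rewrite e = λ ()
  ... | no _ = ∣∣≢⇒≢act s (bounded x)

  colourable : Colourable G (2 * m + 1 + 1)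
  colourable =
    assign w (+ suc m) recolour ,
    assign-colours w (M-top-exact (+ suc m) refl) (λ x _ → recolour-colours x) ,
    proper-assign G w recolour-away toward

colourable-suc : ∀ G w k φ → (∀ x → M k (φ x)) → ProperAway G w φ → Colourable G (k + 1)
colourable-suc G w k φ colours away with evenOrOdd k
... | even m = EvenExtension.colourable G w m φ colours away
... | odd  m = OddExtension.colourable G w m φ colours away

module Identification (G H : SignedGraph) (a : Adjacency (n G)) (u v : Fin (n G))
                      (f : Fin (n G) → Fin (n H)) (identified : IdentifiedBy G H a u v f) where

  preimage : Fin (n H) → Fin (n G)
  preimage b = proj₁ (proj₁ (proj₂ (proj₂ identified)) b)

  preimage-unique : ∀ {x b} → b ≢ f u → f x ≡ b → x ≡ preimage b
  preimage-unique {x} {b} b≢fu fx≡b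
    with proj₁ (proj₂ identified) x (preimage b)
           (trans fx≡b (sym (proj₂ (proj₁ (proj₂ (proj₂ identified)) b))))
  ... | inj₁ x≡ = x≡
  ... | inj₂ (inj₁ (refl , _)) = ⊥-elim (b≢fu (sym fx≡b))
  ... | inj₂ (inj₂ (refl , _)) = ⊥-elim (b≢fu (trans (sym fx≡b) (sym (proj₁ identified))))

  edgePreserving : EdgePreserving a (adj H) f
  edgePreserving = proj₁ (proj₂ (proj₂ (proj₂ identified)))

  proper-away-pushforward : ∀ {φ} → Proper a φ → ProperAway H (f u) (φ ∘ preimage)
  proper-away-pushforward proper b c s b≢ c≢ e
    with proj₂ (proj₂ (proj₂ (proj₂ identified))) b c s e
  ... | x , y , fx≡b , fy≡c , e′
    with preimage-unique b≢ fx≡b | preimage-unique c≢ fy≡c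
  ... | refl | refl = proper x y s e′

colourable-image : ∀ G H S u v f {k} → IdentifiedBy G H (switchAdj G S) u v f →
                   Colourable G k → Colourable H (k + 1)
colourable-image G H S u v f {k} identified (φ , colours , proper) =
  colourable-suc H (f u) k (switchColouring S φ ∘ preimage)
    (λ b → M-act (sign (S (preimage b))) (φ (preimage b)) (colours _))
    (proper-away-pushforward (proper-switch G S proper))
  where open Identification G H (switchAdj G S) u v f identified

chromatic-minimal : ∀ G {k j} → IsChromaticNumber G k → 1 ≤ j → Colourable G j → k ≤ j
chromatic-minimal G (_ , _ , minimal) 1≤j colourable =
  ≮⇒≥ (λ j<k → minimal _ 1≤j j<k colourable)

theorem3p9 : (G H : SignedGraph) → ElementaryImage G H →
    (χG χH : ℕ) → IsChromaticNumber G χG → IsChromaticNumber H χH →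
    χG ≤ χH × χH ≤ χG + 1
theorem3p9 G H (u , v , S , _ , _ , f , identified) χG χH
           χG-chromatic@(1≤χG , colourableG , _) χH-chromatic@(1≤χH , colourableH , _) =
  chromatic-minimal G χG-chromatic 1≤χH
    (colourable-pullback G H S edgePreserving colourableH) ,
  chromatic-minimal H χH-chromatic (≤-trans 1≤χG (m≤m+n χG 1))
    (colourable-image G H S u v f identified colourableG)
  where open Identification G H (switchAdj G S) u v f identified
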